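{- Let $G$ be a finite simple graph with $n$ vertices having at least two disjoint edges. If $k \geq \min\{n-1, \Gamma(G)+\gamma(G)\}$, then $D_k(G)$ is connected.
   Context: A set $S \subseteq V(G)$ is a dominating set of $G$ if every vertex of $V(G)\setminus S$ is adjacent to a vertex of $S$; it is minimal if no proper subset is a dominating set. $\gamma(G)$ is the minimum cardinality of a dominating set of $G$, and $\Gamma(G)$ is the maximum cardinality of a minimal dominating set of $G$. For an integer $k \geq \gamma(G)$, the $k$-dominating graph $D_k(G)$ is the graph whose vertices are the dominating sets of $G$ of cardinality at most $k$, two such sets $A,B$ being adjacent if and only if their symmetric difference $(A\setminus B)\cup(B\setminus A)$ consists of exactly one vertex of $G$. -}

module Defs where

open import Data.Nat using (ℕ; _≤_)
open import Data.Fin using (Fin)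
open import Data.Fin.Subset using (Subset; _∈_; _∉_; _⊂_; _∪_; _─_; ⁅_⁆; ∣_∣)
open import Data.Bool using (Bool; true; false)
open import Data.Product using (Σ; ∃; _×_; _,_; proj₁)
open import Data.Sum using (_⊎_)
open import Relation.Nullary using (¬_)
open import Relation.Binary.PropositionalEquality using (_≡_; _≢_)
open import Relation.Binary.Construct.Closure.ReflexiveTransitive using (Star)

record Graph (n : ℕ) : Set where
  field
    Adj   : Fin n → Fin n → Bool
    sym   : ∀ u v → Adj u v ≡ Adj v u
    irref : ∀ v → Adj v v ≡ false
open Graph public

module _ {n : ℕ} (G : Graph n) where

  Dominating : Subset n → Set
  Dominating S = ∀ v → v ∉ S → ∃ λ u → u ∈ S × Adj G u v ≡ true

  MinimalDominating : Subset n → Set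
  MinimalDominating S = Dominating S × (∀ T → T ⊂ S → ¬ Dominating T)

  IsDominationNumber : ℕ → Set
  IsDominationNumber g =
    (∃ λ S → Dominating S × ∣ S ∣ ≡ g) × (∀ S → Dominating S → g ≤ ∣ S ∣)

  IsUpperDominationNumber : ℕ → Set
  IsUpperDominationNumber m =
    (∃ λ S → MinimalDominating S × ∣ S ∣ ≡ m) × (∀ S → MinimalDominating S → ∣ S ∣ ≤ m)

  HasTwoDisjointEdges : Set
  HasTwoDisjointEdges = ∃ λ a → ∃ λ b → ∃ λ c → ∃ λ d →
    Adj G a b ≡ true × Adj G c d ≡ true ×
    a ≢ c × a ≢ d × b ≢ c × b ≢ d

  DkVertex : ℕ → Set
  DkVertex k = Σ (Subset n) λ S → Dominating S × ∣ S ∣ ≤ k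

  DkAdj : (k : ℕ) → DkVertex k → DkVertex k → Set
  DkAdj k A B = ∃ λ v → ((proj₁ A ─ proj₁ B) ∪ (proj₁ B ─ proj₁ A)) ≡ ⁅ v ⁆

  DkConnected : ℕ → Set
  DkConnected k = ∀ (A B : DkVertex k) → Star (DkAdj k) A B

module Submission where

-- A convenient invariant is "S ⟿ T": the subsets S and T are joined by a walk
-- in D_k(G) for every choice of validity witnesses at the two ends.  The basic
-- tool is the ascent lemma: if A ⊆ B, A is dominating and |B| ≤ k, then A and B
-- are joined, by adding the vertices of B ∖ A one at a time.  D_k(G) is then
-- connected as soon as some hub H lies on a closed walk and every vertex of
-- D_k(G) is joined to H.
--
-- Case n−1 ≤ k.  The co-singletons V∖{x} are vertices of D_k(G).  Two of them,
-- V∖{x} and V∖{u}, are joined through V∖{x,u} whenever x and u each have a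
-- neighbour other than the other one; the two disjoint edges ab, cd make every
-- V∖{x} reachable from the hub V∖{a}, and each dominating A ⊆ V∖{x} ascends to it.
--
-- Case Γ+γ ≤ k < n.  Fix a minimum dominating set D as hub.  A dominating A
-- contains a minimal dominating M, and |M ∪ D| ≤ Γ + γ ≤ k, so A, M, M ∪ D, D are
-- successively joined by ascents; D ∪ {w} for some w ∉ D closes a walk at D.

open import Defs
open import Data.Nat using (ℕ; zero; suc; _≤_; _<_; _+_; _∸_; _⊓_; z≤n; s≤s; _≤?_)
open import Data.Nat.Properties
  using (≤-trans; <-≤-trans; <-irrefl; ≤-reflexive; +-suc; +-comm; +-monoʳ-≤; +-monoˡ-≤;
         m≤n+m; m≤m+n; m∸n≤m; n<1+n; ≤-pred; ≰⇒>; ⊓-sel)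
open import Data.Fin using (Fin; zero; suc) renaming (_≟_ to _≟ᶠ_)
open import Data.Fin.Properties using (any?; all?)
open import Data.Fin.Subset
open import Data.Fin.Subset.Properties
open import Data.Bool using (true; false)
open import Data.Bool.Properties using () renaming (_≟_ to _≟ᵇ_)
open import Data.Vec using ([]; _∷_; here; there)
open import Data.Product using (∃; _×_; _,_; proj₁)
open import Data.Sum using (_⊎_; inj₁; inj₂)
open import Data.Empty using (⊥-elim)
open import Function using (_∘_; id)
open import Relation.Nullary using (¬_; Dec; yes; no)
open import Relation.Nullary.Decidable using (¬?; _×-dec_; _→-dec_)
open import Relation.Binary.PropositionalEquality
  using (_≡_; _≢_; refl; trans; cong; subst; ≢-sym) renaming (sym to ≡-sym)
open import Relation.Binary.Construct.Closure.ReflexiveTransitive using (Star; ε; _◅_; _◅◅_; reverse)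

symdiff-∪⊥ : ∀ {n} (S : Subset n) → (S ─ (S ∪ ⊥)) ∪ ((S ∪ ⊥) ─ S) ≡ ⊥
symdiff-∪⊥ []          = refl
symdiff-∪⊥ (true ∷ S)  = cong (false ∷_) (symdiff-∪⊥ S)
symdiff-∪⊥ (false ∷ S) = cong (false ∷_) (symdiff-∪⊥ S)

symdiff-insert : ∀ {n} (S : Subset n) (v : Fin n) → v ∉ S →
                 (S ─ (S ∪ ⁅ v ⁆)) ∪ ((S ∪ ⁅ v ⁆) ─ S) ≡ ⁅ v ⁆
symdiff-insert (true ∷ S)  zero    v∉S = ⊥-elim (v∉S here)
symdiff-insert (false ∷ S) zero    v∉S = cong (true ∷_) (symdiff-∪⊥ S)
symdiff-insert (true ∷ S)  (suc v) v∉S = cong (false ∷_) (symdiff-insert S v (v∉S ∘ there))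
symdiff-insert (false ∷ S) (suc v) v∉S = cong (false ∷_) (symdiff-insert S v (v∉S ∘ there))

∈─⇒∉ : ∀ {n} {x : Fin n} (p q : Subset n) → x ∈ p ─ q → x ∉ q
∈─⇒∉ (s ∷ p) (true ∷ q)  ()        here
∈─⇒∉ (s ∷ p) (false ∷ q) here      ()
∈─⇒∉ (s ∷ p) (t ∷ q)     (there h) (there h') = ∈─⇒∉ p q h h'

∣p∪q∣≤∣p∣+∣q∣ : ∀ {n} (p q : Subset n) → ∣ p ∪ q ∣ ≤ ∣ p ∣ + ∣ q ∣
∣p∪q∣≤∣p∣+∣q∣ []          []          = z≤n
∣p∪q∣≤∣p∣+∣q∣ (true ∷ p)  (t ∷ q)     =
  s≤s (≤-trans (∣p∪q∣≤∣p∣+∣q∣ p q) (+-monoʳ-≤ ∣ p ∣ (∣p∣≤∣x∷p∣ t q)))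
∣p∪q∣≤∣p∣+∣q∣ (false ∷ p) (true ∷ q)  =
  subst (suc ∣ p ∪ q ∣ ≤_) (≡-sym (+-suc ∣ p ∣ ∣ q ∣)) (s≤s (∣p∪q∣≤∣p∣+∣q∣ p q))
∣p∪q∣≤∣p∣+∣q∣ (false ∷ p) (false ∷ q) = ∣p∪q∣≤∣p∣+∣q∣ p q

∈⇒1≤∣p∣ : ∀ {n} {x : Fin n} {p : Subset n} → x ∈ p → 1 ≤ ∣ p ∣
∈⇒1≤∣p∣ x∈p = ≤-trans (s≤s z≤n) (x∈p⇒∣p-x∣<∣p∣ x∈p)

insert-⊆ : ∀ {n} {A B : Subset n} {v : Fin n} → A ⊆ B → v ∈ B → A ∪ ⁅ v ⁆ ⊆ B
insert-⊆ {A = A} {v = v} A⊆B v∈B {x} x∈ with x∈p∪q⁻ A ⁅ v ⁆ x∈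
... | inj₁ x∈A = A⊆B x∈A
... | inj₂ x∈v = subst (_∈ _) (≡-sym (x∈⁅y⁆⇒x≡y v x∈v)) v∈B

extra-or-equal : ∀ {n} {A B : Subset n} → A ⊆ B → (∃ λ v → v ∈ B × v ∉ A) ⊎ A ≡ B
extra-or-equal {A = A} {B} A⊆B with any? (λ v → v ∈? B ×-dec ¬? (v ∈? A))
... | yes extra  = inj₁ extra
... | no ¬extra  = inj₂ (⊆-antisym A⊆B B⊆A)
  where
    B⊆A : B ⊆ A
    B⊆A {x} x∈B with x ∈? A
    ... | yes x∈A = x∈A
    ... | no  x∉A = ⊥-elim (¬extra (x , x∈B , x∉A))

module Domination {n : ℕ} (G : Graph n) where

  adj-sym : ∀ {x y} → Adj G x y ≡ true → Adj G y x ≡ true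
  adj-sym {x} {y} xy = trans (sym G y x) xy

  adj⇒≢ : ∀ {x y} → Adj G x y ≡ true → x ≢ y
  adj⇒≢ {x} xy refl with trans (≡-sym xy) (irref G x)
  ... | ()

  dominating-mono : ∀ {S T} → S ⊆ T → Dominating G S → Dominating G T
  dominating-mono S⊆T dS v v∉T with dS v (v∉T ∘ S⊆T)
  ... | u , u∈S , uv = u , S⊆T u∈S , uv

  dominating? : ∀ S → Dec (Dominating G S)
  dominating? S =
    all? (λ v → ¬? (v ∈? S) →-dec any? (λ u → u ∈? S ×-dec (Adj G u v ≟ᵇ true)))

  minimal-dominating-subset : ∀ A → Dominating G A → ∃ λ M → M ⊆ A × MinimalDominating G M
  minimal-dominating-subset A = shrink (suc ∣ A ∣) A (n<1+n ∣ A ∣)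
    where
      shrink : ∀ m A → ∣ A ∣ < m → Dominating G A → ∃ λ M → M ⊆ A × MinimalDominating G M
      shrink zero    A ()
      shrink (suc m) A ∣A∣<m dA with any? (λ v → v ∈? A ×-dec dominating? (A - v))
      ... | yes (v , v∈A , dA-v) with shrink m (A - v) (<-≤-trans (x∈p⇒∣p-x∣<∣p∣ v∈A) (≤-pred ∣A∣<m)) dA-v
      ...   | M , M⊆A-v , minM = M , p─q⊆p A ⁅ v ⁆ ∘ M⊆A-v , minM
      shrink (suc m) A ∣A∣<m dA | no ¬deletable = A , id , dA , no-proper
        where
          no-proper : ∀ T → T ⊂ A → ¬ Dominating G T
          no-proper T (T⊆A , v , v∈A , v∉T) dT = ¬deletable (v , v∈A , dominating-mono T⊆A-v dT)
            where
              T⊆A-v : T ⊆ A - v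
              T⊆A-v t∈T = x∈p∧x≢y⇒x∈p-y (T⊆A t∈T) (λ t≡v → v∉T (subst (_∈ T) t≡v t∈T))

module Walks {n : ℕ} (G : Graph n) (k : ℕ) where
  open Domination G

  Valid : Subset n → Set
  Valid S = Dominating G S × ∣ S ∣ ≤ k

  -- S and T are joined by a walk in D_k(G), whatever witnesses of validity
  -- are attached to them (DkVertex carries a witness, not just a set).
  infix 4 _⟿_ _⟿⁼_
  _⟿_ : Subset n → Subset n → Set
  S ⟿ T = (vS : Valid S) (vT : Valid T) → Star (DkAdj G k) (S , vS) (T , vT)

  _⟿⁼_ : Subset n → Subset n → Set
  S ⟿⁼ T = S ≡ T ⊎ S ⟿ T

  ⟿-sym : ∀ {S T} → S ⟿ T → T ⟿ S
  ⟿-sym S⟿T vT vS = reverse (λ {A B} → flip-adj {A} {B}) (S⟿T vS vT)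
    where
      flip-adj : ∀ {A B} → DkAdj G k A B → DkAdj G k B A
      flip-adj {A} {B} (v , AB≡v) = v , trans (∪-comm (proj₁ B ─ proj₁ A) (proj₁ A ─ proj₁ B)) AB≡v

  ⟿-trans : ∀ {S T U} → Valid T → S ⟿ T → T ⟿ U → S ⟿ U
  ⟿-trans vT S⟿T T⟿U vS vU = S⟿T vS vT ◅◅ T⟿U vT vU

  ⟿-loop : ∀ {S T} → Valid T → S ⟿ T → S ⟿ S
  ⟿-loop vT S⟿T = ⟿-trans vT S⟿T (⟿-sym S⟿T)

  ⟿⁼-sym : ∀ {S T} → S ⟿⁼ T → T ⟿⁼ S
  ⟿⁼-sym (inj₁ S≡T) = inj₁ (≡-sym S≡T)
  ⟿⁼-sym (inj₂ S⟿T) = inj₂ (⟿-sym S⟿T)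

  ⟿⁼-trans : ∀ {S T U} → Valid T → S ⟿⁼ T → T ⟿⁼ U → S ⟿⁼ U
  ⟿⁼-trans vT (inj₁ refl) T⟿⁼U        = T⟿⁼U
  ⟿⁼-trans vT (inj₂ S⟿T) (inj₁ refl) = inj₂ S⟿T
  ⟿⁼-trans vT (inj₂ S⟿T) (inj₂ T⟿U) = inj₂ (⟿-trans vT S⟿T T⟿U)

  ⟿⁼-⟿-trans : ∀ {S T U} → Valid T → S ⟿⁼ T → T ⟿ U → S ⟿ U
  ⟿⁼-⟿-trans vT (inj₁ refl) T⟿U = T⟿U
  ⟿⁼-⟿-trans vT (inj₂ S⟿T) T⟿U = ⟿-trans vT S⟿T T⟿U

  insert-edge : ∀ S v → v ∉ S → S ⟿ S ∪ ⁅ v ⁆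
  insert-edge S v v∉S vS vT = (v , symdiff-insert S v v∉S) ◅ ε

  -- Ascent lemma: a dominating A ⊆ B with |B| ≤ k is joined to B, by adding
  -- the vertices of B ∖ A one at a time; m bounds the number of additions.
  ascend-by : ∀ m {A B} → A ⊆ B → ∣ B ∣ ≤ m + ∣ A ∣ → Dominating G A → ∣ B ∣ ≤ k → A ⟿⁼ B
  ascend-by m {A} {B} A⊆B ∣B∣≤m+∣A∣ dA ∣B∣≤k with extra-or-equal A⊆B
  ... | inj₂ A≡B = inj₁ A≡B
  ... | inj₁ (v , v∈B , v∉A) with m
  ...   | zero  = ⊥-elim (<-irrefl refl (<-≤-trans ∣A∣<∣B∣ ∣B∣≤m+∣A∣))
    where
      ∣A∣<∣B∣ : ∣ A ∣ < ∣ B ∣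
      ∣A∣<∣B∣ = p⊂q⇒∣p∣<∣q∣ (A⊆B , v , v∈B , v∉A)
  ...   | suc m′ = ⟿⁼-trans vC (inj₂ (insert-edge A v v∉A)) (ascend-by m′ C⊆B ∣B∣≤m′+∣C∣ dC ∣B∣≤k)
    where
      C = A ∪ ⁅ v ⁆
      C⊆B : C ⊆ B
      C⊆B = insert-⊆ A⊆B v∈B
      dC : Dominating G C
      dC = dominating-mono (p⊆p∪q ⁅ v ⁆) dA
      vC : Valid C
      vC = dC , ≤-trans (p⊆q⇒∣p∣≤∣q∣ C⊆B) ∣B∣≤k
      ∣A∣<∣C∣ : ∣ A ∣ < ∣ C ∣
      ∣A∣<∣C∣ = p⊂q⇒∣p∣<∣q∣ (p⊆p∪q ⁅ v ⁆ , v , q⊆p∪q A ⁅ v ⁆ (x∈⁅x⁆ v) , v∉A)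
      ∣B∣≤m′+∣C∣ : ∣ B ∣ ≤ m′ + ∣ C ∣
      ∣B∣≤m′+∣C∣ = ≤-trans ∣B∣≤m+∣A∣ (≤-trans (≤-reflexive (≡-sym (+-suc m′ ∣ A ∣))) (+-monoʳ-≤ m′ ∣A∣<∣C∣))

  ascend : ∀ {A B} → A ⊆ B → Dominating G A → ∣ B ∣ ≤ k → A ⟿⁼ B
  ascend {A} {B} A⊆B = ascend-by ∣ B ∣ A⊆B (m≤m+n ∣ B ∣ ∣ A ∣)

  ascend-strict : ∀ {A B v} → A ⊆ B → v ∈ B → v ∉ A → Dominating G A → ∣ B ∣ ≤ k → A ⟿ B
  ascend-strict A⊆B v∈B v∉A dA ∣B∣≤k with ascend A⊆B dA ∣B∣≤k
  ... | inj₁ refl = ⊥-elim (v∉A v∈B)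
  ... | inj₂ A⟿B = A⟿B

  hub-connected : ∀ H → Valid H → H ⟿ H → (∀ A → Valid A → A ⟿⁼ H) → DkConnected G k
  hub-connected H vH H⟿H to-hub (A , vA) (B , vB) =
    A⟿H vA vH ◅◅ ⟿-sym B⟿H vH vB
    where
      A⟿H : A ⟿ H
      A⟿H = ⟿⁼-⟿-trans vH (to-hub A vA) H⟿H
      B⟿H : B ⟿ H
      B⟿H = ⟿⁼-⟿-trans vH (to-hub B vB) H⟿H

  module CoSingletons (n∸1≤k : n ∸ 1 ≤ k) where

    Co : Fin n → Subset n
    Co x = ∁ ⁅ x ⁆

    ∈Co : ∀ {x y} → y ≢ x → y ∈ Co x
    ∈Co y≢x = x∉p⇒x∈∁p (x≢y⇒x∉⁅y⁆ y≢x)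

    ∉Co : ∀ x → x ∉ Co x
    ∉Co x = x∈p⇒x∉∁p (x∈⁅x⁆ x)

    Co-dominating : ∀ {x y} → Adj G y x ≡ true → Dominating G (Co x)
    Co-dominating {x} {y} yx v v∉Co with x∈⁅y⁆⇒x≡y x (x∉∁p⇒x∈p v∉Co)
    ... | refl = y , ∈Co (adj⇒≢ yx) , yx

    ∣Co∣≤k : ∀ x → ∣ Co x ∣ ≤ k
    ∣Co∣≤k x = subst (_≤ k) (≡-sym ∣Co∣≡n∸1) n∸1≤k
      where
        ∣Co∣≡n∸1 : ∣ Co x ∣ ≡ n ∸ 1
        ∣Co∣≡n∸1 = trans (∣∁p∣≡n∸∣p∣ ⁅ x ⁆) (cong (n ∸_) (∣⁅x⁆∣≡1 x))

    Co-valid : ∀ {x y} → Adj G y x ≡ true → Valid (Co x)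
    Co-valid {x} yx = Co-dominating yx , ∣Co∣≤k x

    NeighbourAvoiding : Fin n → Fin n → Set
    NeighbourAvoiding x u = ∃ λ y → Adj G y x ≡ true × y ≢ u

    -- Bridge: V ∖ {x} and V ∖ {u} are joined through the dominating set
    -- V ∖ {x, u}, provided x and u each have a neighbour other than the other.
    bridge : ∀ {x u} → x ≢ u → NeighbourAvoiding x u → NeighbourAvoiding u x → Co x ⟿ Co u
    bridge {x} {u} x≢u (y , yx , y≢u) (q , qu , q≢x) =
      ⟿-trans (dXU , ∣XU∣≤k) (⟿-sym XU⟿Cox) XU⟿Cou
      where
        XU = Co x - u
        XU⊆Cox : XU ⊆ Co x
        XU⊆Cox = p─q⊆p (Co x) ⁅ u ⁆
        XU⊆Cou : XU ⊆ Co u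
        XU⊆Cou w∈XU = x∉p⇒x∈∁p (∈─⇒∉ (Co x) ⁅ u ⁆ w∈XU)
        ∣XU∣≤k : ∣ XU ∣ ≤ k
        ∣XU∣≤k = ≤-trans (p⊆q⇒∣p∣≤∣q∣ XU⊆Cox) (∣Co∣≤k x)
        dXU : Dominating G XU
        dXU v v∉XU with v ≟ᶠ x | v ≟ᶠ u
        ... | yes refl | _        = y , x∈p∧x≢y⇒x∈p-y (∈Co (adj⇒≢ yx)) y≢u , yx
        ... | no _     | yes refl = q , x∈p∧x≢y⇒x∈p-y (∈Co q≢x) (adj⇒≢ qu) , qu
        ... | no v≢x   | no v≢u   = ⊥-elim (v∉XU (x∈p∧x≢y⇒x∈p-y (∈Co v≢x) v≢u))
        XU⟿Cox : XU ⟿ Co x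
        XU⟿Cox = ascend-strict XU⊆Cox (∈Co (≢-sym x≢u)) (λ u∈XU → ∈─⇒∉ (Co x) ⁅ u ⁆ u∈XU (x∈⁅x⁆ u))
                               dXU (∣Co∣≤k x)
        XU⟿Cou : XU ⟿ Co u
        XU⟿Cou = ascend-strict XU⊆Cou (∈Co x≢u) (∉Co x ∘ XU⊆Cox) dXU (∣Co∣≤k u)

    bridge-to-edge : ∀ {x y p q} → Adj G y x ≡ true → Adj G p q ≡ true → p ≢ x → q ≢ x →
                     Co x ⟿ Co p ⊎ Co x ⟿ Co q
    bridge-to-edge {y = y} {p} yx pq p≢x q≢x with y ≟ᶠ p
    ... | yes refl = inj₂ (bridge (≢-sym q≢x) (y , yx , adj⇒≢ pq) (y , pq , p≢x))
    ... | no y≢p   = inj₁ (bridge (≢-sym p≢x) (y , yx , y≢p) (_ , adj-sym pq , q≢x))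

    module TwoEdges {a b c d : Fin n} (ab : Adj G a b ≡ true) (cd : Adj G c d ≡ true)
                    (a≢c : a ≢ c) (a≢d : a ≢ d) (b≢c : b ≢ c) (b≢d : b ≢ d) where

      ba : Adj G b a ≡ true
      ba = adj-sym ab
      dc : Adj G d c ≡ true
      dc = adj-sym cd

      c⟿a : Co c ⟿ Co a
      c⟿a = bridge (≢-sym a≢c) (d , dc , ≢-sym a≢d) (b , ba , b≢c)

      d⟿a : Co d ⟿ Co a
      d⟿a = bridge (≢-sym a≢d) (c , cd , ≢-sym a≢c) (b , ba , b≢d)

      b⟿a : Co b ⟿ Co a
      b⟿a = ⟿-trans (Co-valid dc) (bridge b≢c (a , ab , a≢c) (d , dc , ≢-sym b≢d)) c⟿a

      via-ab : ∀ {x} → Co x ⟿ Co a ⊎ Co x ⟿ Co b → Co x ⟿⁼ Co a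
      via-ab (inj₁ x⟿a) = inj₂ x⟿a
      via-ab (inj₂ x⟿b) = inj₂ (⟿-trans (Co-valid ab) x⟿b b⟿a)

      via-cd : ∀ {x} → Co x ⟿ Co c ⊎ Co x ⟿ Co d → Co x ⟿⁼ Co a
      via-cd (inj₁ x⟿c) = inj₂ (⟿-trans (Co-valid dc) x⟿c c⟿a)
      via-cd (inj₂ x⟿d) = inj₂ (⟿-trans (Co-valid cd) x⟿d d⟿a)

      Co⟿hub : ∀ {x y} → Adj G y x ≡ true → Co x ⟿⁼ Co a
      Co⟿hub {x} yx with x ≟ᶠ c | x ≟ᶠ d
      ... | yes refl | _        = via-ab (bridge-to-edge yx ab a≢c b≢c)
      ... | no _     | yes refl = via-ab (bridge-to-edge yx ab a≢d b≢d)
      ... | no x≢c   | no x≢d   = via-cd (bridge-to-edge yx cd (≢-sym x≢c) (≢-sym x≢d))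

      -- Every vertex A of D_k(G) is joined to the hub: if x ∉ A then A ascends
      -- to V ∖ {x}; otherwise A = V and V ∖ {a} ascends to A.
      to-hub : ∀ A → Valid A → A ⟿⁼ Co a
      to-hub A (dA , ∣A∣≤k) with extra-or-equal (⊆⊤ {p = A})
      ... | inj₂ refl = ⟿⁼-sym (ascend ⊆⊤ (Co-dominating ba) ∣A∣≤k)
      ... | inj₁ (x , _ , x∉A) with dA x x∉A
      ...   | y , y∈A , yx = ⟿⁼-trans (Co-valid yx) (ascend A⊆Cox dA (∣Co∣≤k x)) (Co⟿hub yx)
        where
          A⊆Cox : A ⊆ Co x
          A⊆Cox w∈A = ∈Co (λ w≡x → x∉A (subst (_∈ A) w≡x w∈A))

      connected : DkConnected G k
      connected = hub-connected (Co a) (Co-valid ba) (⟿-loop (Co-valid dc) (⟿-sym c⟿a)) to-hub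

  module AboveUpperDomination {Γ : ℕ} (D : Subset n) (dD : Dominating G D)
           (upper : ∀ S → MinimalDominating G S → ∣ S ∣ ≤ Γ)
           (Γ+∣D∣≤k : Γ + ∣ D ∣ ≤ k) (k<n : k < n) where

    ∣D∣≤k : ∣ D ∣ ≤ k
    ∣D∣≤k = ≤-trans (m≤n+m ∣ D ∣ Γ) Γ+∣D∣≤k

    -- A ⊇ M ⊆ M ∪ D ⊇ D with M minimal, and |M ∪ D| ≤ Γ + |D| ≤ k.
    to-hub : ∀ A → Valid A → A ⟿⁼ D
    to-hub A (dA , ∣A∣≤k) with minimal-dominating-subset A dA
    ... | M , M⊆A , minM@(dM , _) =
      ⟿⁼-trans vM (⟿⁼-sym (ascend M⊆A dM ∣A∣≤k))
        (⟿⁼-trans vMD (ascend (p⊆p∪q D) dM ∣MD∣≤k) (⟿⁼-sym (ascend (q⊆p∪q M D) dD ∣MD∣≤k)))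
      where
        vM : Valid M
        vM = dM , ≤-trans (p⊆q⇒∣p∣≤∣q∣ M⊆A) ∣A∣≤k
        ∣MD∣≤k : ∣ M ∪ D ∣ ≤ k
        ∣MD∣≤k = ≤-trans (∣p∪q∣≤∣p∣+∣q∣ M D) (≤-trans (+-monoˡ-≤ ∣ D ∣ (upper M minM)) Γ+∣D∣≤k)
        vMD : Valid (M ∪ D)
        vMD = dominating-mono (p⊆p∪q D) dM , ∣MD∣≤k

    -- Since |D| < n some w lies outside D, and D ∪ {w} is a neighbour of D
    -- (Γ ≥ 1, as a minimal dominating set dominates w); hence a closed walk at D.
    hub-loop : D ⟿ D
    hub-loop with extra-or-equal (⊆⊤ {p = D})
    ... | inj₂ D≡⊤ = ⊥-elim (<-irrefl refl (<-≤-trans k<n n≤k))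
      where
        n≤k : n ≤ k
        n≤k = subst (_≤ k) (trans (cong ∣_∣ D≡⊤) (∣⊤∣≡n n)) ∣D∣≤k
    ... | inj₁ (w , _ , w∉D) = ⟿-loop (dominating-mono (p⊆p∪q ⁅ w ⁆) dD , ∣D+w∣≤k) (insert-edge D w w∉D)
      where
        1≤Γ : 1 ≤ Γ
        1≤Γ with minimal-dominating-subset D dD
        ... | M , M⊆D , minM@(dM , _) with dM w (w∉D ∘ M⊆D)
        ...   | u , u∈M , _ = ≤-trans (∈⇒1≤∣p∣ u∈M) (upper M minM)
        ∣D+w∣≤k : ∣ D ∪ ⁅ w ⁆ ∣ ≤ k
        ∣D+w∣≤k = ≤-trans (∣p∪q∣≤∣p∣+∣q∣ D ⁅ w ⁆)
                    (subst (λ s → ∣ D ∣ + s ≤ k) (≡-sym (∣⁅x⁆∣≡1 w))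
                      (≤-trans (+-monoʳ-≤ ∣ D ∣ 1≤Γ) (subst (_≤ k) (+-comm Γ ∣ D ∣) Γ+∣D∣≤k)))

    connected : DkConnected G k
    connected = hub-connected D (dD , ∣D∣≤k) hub-loop to-hub

⊓-≤-right : ∀ {m m′ k} → ¬ m ≤ k → m ⊓ m′ ≤ k → m′ ≤ k
⊓-≤-right {m} {m′} m≰k m⊓m′≤k with ⊓-sel m m′
... | inj₁ m⊓m′≡m  = ⊥-elim (m≰k (subst (_≤ _) m⊓m′≡m m⊓m′≤k))
... | inj₂ m⊓m′≡m′ = subst (_≤ _) m⊓m′≡m′ m⊓m′≤k

theorem5 : ∀ {n : ℕ} (G : Graph n) → HasTwoDisjointEdges G →
    ∀ (g Γ k : ℕ) → IsDominationNumber G g → IsUpperDominationNumber G Γ →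
    ((n ∸ 1) ⊓ (Γ + g)) ≤ k → DkConnected G k
theorem5 {n} G (a , b , c , d , ab , cd , a≢c , a≢d , b≢c , b≢d) g Γ k
         ((D , dD , ∣D∣≡g) , _) (_ , upper) min≤k with n ∸ 1 ≤? k
... | yes n∸1≤k = CoSingletons.TwoEdges.connected n∸1≤k ab cd a≢c a≢d b≢c b≢d
  where open Walks G k
... | no n∸1≰k  = AboveUpperDomination.connected D dD upper Γ+∣D∣≤k k<n
  where
    open Walks G k
    Γ+∣D∣≤k : Γ + ∣ D ∣ ≤ k
    Γ+∣D∣≤k = subst (λ s → Γ + s ≤ k) (≡-sym ∣D∣≡g) (⊓-≤-right n∸1≰k min≤k)
    k<n : k < n
    k<n = <-≤-trans (≰⇒> n∸1≰k) (m∸n≤m n 1)
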